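{- Let $M$ be a matroid on $E$ and $F_1,\dots,F_m\subseteq E$. Then every independent set of $\bigodot_{i=1}^m M(F_i)$ is independent in each $M(F_i)$, $i=1,\dots,m$.
   Context: For $F\subseteq E$, $M(F):=(M/F)\oplus(M|_F)$, a matroid on $E$. For $\sigma\subseteq[m]$, $F^+_\sigma=\bigcup_{i\in\sigma}F_i$, $F^-_\sigma=\bigcap_{j\notin\sigma}F_j$ ($F^-_{[m]}=E$), and $\bigodot_{i=1}^m M(F_i):=\bigoplus_{\sigma\subseteq[m]}(M/F^+_\sigma)|_{F^-_\sigma\setminus F^+_\sigma}$, a matroid on $E$. -}

module Defs where

open import Data.Nat using (ℕ; _<_)
open import Data.Bool using (if_then_else_)
open import Data.Fin using (Fin)
open import Data.Fin.Subset
open import Data.List using (List; map; allFin)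
open import Data.Vec using (lookup)
open import Data.Product using (Σ; _×_; ∃)
open import Relation.Nullary using (¬_)
open import Relation.Binary.PropositionalEquality using (_≡_)

record Matroid (n : ℕ) : Set₁ where
  field
    Indep     : Subset n → Set
    indep-∅   : Indep ⊥
    indep-⊆   : ∀ {I J} → J ⊆ I → Indep I → Indep J
    augment   : ∀ {I J} → Indep I → Indep J → ∣ I ∣ < ∣ J ∣ →
                ∃ λ x → x ∈ J × x ∉ I × Indep (⁅ x ⁆ ∪ I)
open Matroid public

module _ {n : ℕ} (M : Matroid n) where

  IsBasisOf : Subset n → Subset n → Set
  IsBasisOf F B = B ⊆ F × Indep M B ×
                  (∀ x → x ∈ F → x ∉ B → ¬ Indep M (⁅ x ⁆ ∪ B))

  IndepRestr : Subset n → Subset n → Set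
  IndepRestr F I = I ⊆ F × Indep M I

  -- independence in the contraction M/F (a matroid on E ∖ F):
  -- I ⊆ E ∖ F and I ∪ B independent in M for a basis B of M|_F
  IndepContr : Subset n → Subset n → Set
  IndepContr F I = I ⊆ ∁ F × Σ (Subset n) (λ B → IsBasisOf F B × Indep M (I ∪ B))

  IndepContrRestr : Subset n → Subset n → Subset n → Set
  IndepContrRestr F X I = I ⊆ X × IndepContr F I

  -- independence in M(F) = (M/F) ⊕ (M|_F), a matroid on E
  IndepMF : Subset n → Subset n → Set
  IndepMF F I = IndepContr F (I ─ F) × IndepRestr F (I ∩ F)

module _ {n m : ℕ} where

  F⁺ : (Fin m → Subset n) → Subset m → Subset n
  F⁺ F σ = ⋃ (map (λ i → if lookup σ i then F i else ⊥) (allFin m))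

  -- F⁻_σ = ⋂_{j ∉ σ} F_j   (empty intersection = E)
  F⁻ : (Fin m → Subset n) → Subset m → Subset n
  F⁻ F σ = ⋂ (map (λ j → if lookup σ j then ⊤ else F j) (allFin m))

  -- independence in ⊙_{i=1}^m M(F_i) = ⊕_σ (M/F⁺_σ)|_{F⁻_σ ∖ F⁺_σ}:
  -- I ∩ (F⁻_σ ∖ F⁺_σ) is independent in the σ-summand, for every σ ⊆ [m]
  IndepOdot : Matroid n → (Fin m → Subset n) → Subset n → Set
  IndepOdot M F I = ∀ (σ : Subset m) →
    let X = F⁻ F σ ─ F⁺ F σ in IndepContrRestr M (F⁺ F σ) X (I ∩ X)

module Submission where

-- The summands of ⊙ᵢ M(Fᵢ) live on the blocks X σ = F⁻_σ ∖ F⁺_σ, which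
-- partition E: e lies in the block of its signature sig e = {j ∣ e ∉ F j}.
-- The σ-summand condition says I ∩ X σ is independent in M / F⁺_σ; by the
-- contraction lemma, (I ∩ X σ) ∪ J is then independent for every independent
-- J ⊆ F⁺_σ.  The main induction adds the elements of S ⊆ I to an independent
-- J, absorbing last an element e of largest signature: every other element
-- then lies in F⁺_{sig e} or in the block of e.  With J = ∅ this shows I (so
-- I ∩ Fᵢ) independent; with J a basis of Fᵢ = F⁺_{⁅i⁆} and S = I ∖ Fᵢ it shows
-- I ∖ Fᵢ independent in M / Fᵢ.  Together: independence in M(Fᵢ).

open import Defs
open import Data.Nat using (ℕ; zero; suc; _≤_; _<_; _+_; z≤n; s≤s; _≤?_)
open import Data.Nat.Properties
  using (≤-refl; ≤-trans; <-≤-trans; +-suc; +-monoʳ-≤; n≤1+n; m≤m+n; ≮⇒≥;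
         <-irrefl; ≰⇒>; <⇒≤; +-cancelʳ-≤)
open import Data.Fin using (Fin; zero; suc; _≟_)
open import Data.Fin.Subset
open import Data.Fin.Subset.Properties
  using (p⊆q⇒∣p∣≤∣q∣; p⊂q⇒∣p∣<∣q∣; _∈?_; ∉⊥; x∈⁅x⁆; x∈⁅y⁆⇒x≡y; p∩q⊆p; p∩q⊆q;
         x∈p∩q⁺; p⊆p∪q; q⊆p∪q; x∈p∪q⁻; x∈p∪q⁺; x∈p∧x∉q⇒x∈p─q; p─q⊆p;
         x∈p∧x≢y⇒x∈p-y; x∈p⇒∣p-x∣<∣p∣; x∉p⇒x∈∁p; x∈∁p⇒x∉p; ∈⊤; ∣⁅x⁆∣≡1)
open import Data.Bool using (true; false; if_then_else_)
open import Data.Vec using ([]; _∷_; lookup; tabulate; here; there)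
open import Data.Vec.Properties using ([]=⇒lookup; lookup⇒[]=; lookup∘tabulate)
open import Data.List using (List; []; _∷_; map; allFin)
open import Data.List.Relation.Unary.Any using (here; there)
open import Data.List.Membership.Propositional using () renaming (_∈_ to _∈ˡ_)
open import Data.List.Membership.Propositional.Properties using (∈-allFin)
open import Data.Product using (_×_; ∃; _,_)
open import Data.Sum using (_⊎_; inj₁; inj₂)
open import Relation.Nullary using (yes; no; contradiction)
open import Relation.Binary.PropositionalEquality using (refl; sym; trans; subst)

x∈p─q⇒x∉q : ∀ {n} {x : Fin n} (p q : Subset n) → x ∈ p ─ q → x ∉ q
x∈p─q⇒x∉q (_ ∷ p) (true ∷ q) () here
x∈p─q⇒x∉q (_ ∷ p) (_ ∷ q) (there x∈p─q) (there x∈q) = x∈p─q⇒x∉q p q x∈p─q x∈q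

∣p∪q∣≤∣p∣+∣q∣ : ∀ {n} (p q : Subset n) → ∣ p ∪ q ∣ ≤ ∣ p ∣ + ∣ q ∣
∣p∪q∣≤∣p∣+∣q∣ []         []         = z≤n
∣p∪q∣≤∣p∣+∣q∣ (true ∷ p) (true ∷ q) =
  s≤s (≤-trans (∣p∪q∣≤∣p∣+∣q∣ p q) (+-monoʳ-≤ ∣ p ∣ (n≤1+n _)))
∣p∪q∣≤∣p∣+∣q∣ (true ∷ p) (false ∷ q) = s≤s (∣p∪q∣≤∣p∣+∣q∣ p q)
∣p∪q∣≤∣p∣+∣q∣ (false ∷ p) (true ∷ q) rewrite +-suc ∣ p ∣ ∣ q ∣ = s≤s (∣p∪q∣≤∣p∣+∣q∣ p q)
∣p∪q∣≤∣p∣+∣q∣ (false ∷ p) (false ∷ q) = ∣p∪q∣≤∣p∣+∣q∣ p q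

disjoint⇒∣p∣+∣q∣≤∣p∪q∣ : ∀ {n} (p q : Subset n) → (∀ {x} → x ∈ p → x ∉ q) →
                          ∣ p ∣ + ∣ q ∣ ≤ ∣ p ∪ q ∣
disjoint⇒∣p∣+∣q∣≤∣p∪q∣ []          []          _ = z≤n
disjoint⇒∣p∣+∣q∣≤∣p∪q∣ (true ∷ p)  (true ∷ q)  d = contradiction here (d here)
disjoint⇒∣p∣+∣q∣≤∣p∪q∣ (true ∷ p)  (false ∷ q) d =
  s≤s (disjoint⇒∣p∣+∣q∣≤∣p∪q∣ p q λ x∈p x∈q → d (there x∈p) (there x∈q))
disjoint⇒∣p∣+∣q∣≤∣p∪q∣ (false ∷ p) (true ∷ q)  d rewrite +-suc ∣ p ∣ ∣ q ∣ =
  s≤s (disjoint⇒∣p∣+∣q∣≤∣p∪q∣ p q λ x∈p x∈q → d (there x∈p) (there x∈q))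
disjoint⇒∣p∣+∣q∣≤∣p∪q∣ (false ∷ p) (false ∷ q) d =
  disjoint⇒∣p∣+∣q∣≤∣p∪q∣ p q λ x∈p x∈q → d (there x∈p) (there x∈q)

∣p∣≤∣p─q∣+∣p∩q∣ : ∀ {n} (X A : Subset n) → ∣ X ∣ ≤ ∣ X ─ A ∣ + ∣ X ∩ A ∣
∣p∣≤∣p─q∣+∣p∩q∣ X A = ≤-trans (p⊆q⇒∣p∣≤∣q∣ split) (∣p∪q∣≤∣p∣+∣q∣ (X ─ A) (X ∩ A))
  where
  split : X ⊆ (X ─ A) ∪ (X ∩ A)
  split {x} x∈X with x ∈? A
  ... | yes x∈A = x∈p∪q⁺ (inj₂ (x∈p∩q⁺ (x∈X , x∈A)))
  ... | no  x∉A = x∈p∪q⁺ (inj₁ (x∈p∧x∉q⇒x∈p─q x∈X x∉A))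

⊆∧∣q∣≤∣p∣⇒q⊆p : ∀ {n} {p q : Subset n} → p ⊆ q → ∣ q ∣ ≤ ∣ p ∣ → q ⊆ p
⊆∧∣q∣≤∣p∣⇒q⊆p {p = p} {q} p⊆q ∣q∣≤∣p∣ {x} x∈q with x ∈? p
... | yes x∈p = x∈p
... | no  x∉p = contradiction (<-≤-trans (p⊂q⇒∣p∣<∣q∣ (p⊆q , x , x∈q , x∉p)) ∣q∣≤∣p∣)
                             (<-irrefl refl)

argmax : ∀ {n} (f : Fin n → ℕ) (S : Subset n) →
         (∀ x → x ∉ S) ⊎ ∃ λ e → e ∈ S × (∀ {e′} → e′ ∈ S → f e′ ≤ f e)
argmax f [] = inj₁ λ _ ()
argmax f (b ∷ S) with argmax (λ x → f (suc x)) S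
argmax f (false ∷ S) | inj₁ empty = inj₁ λ { zero () ; (suc x) (there x∈S) → empty x x∈S }
argmax f (false ∷ S) | inj₂ (e , e∈S , max) =
  inj₂ (suc e , there e∈S , λ { (there e′∈S) → max e′∈S })
argmax f (true ∷ S) | inj₁ empty =
  inj₂ (zero , here , λ { here → ≤-refl ; {suc e′} (there e′∈S) → contradiction e′∈S (empty e′) })
argmax f (true ∷ S) | inj₂ (e , e∈S , max) with f zero ≤? f (suc e)
... | yes f0≤fe = inj₂ (suc e , there e∈S , λ { here → f0≤fe ; (there e′∈S) → max e′∈S })
... | no  f0≰fe = inj₂ (zero , here , λ { here → ≤-refl
                                        ; (there e′∈S) → ≤-trans (max e′∈S) (<⇒≤ (≰⇒> f0≰fe)) })

∈⋃⁺ : ∀ {n k} {x : Fin n} (g : Fin k → Subset n) {l : List (Fin k)} {j} →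
      j ∈ˡ l → x ∈ g j → x ∈ ⋃ (map g l)
∈⋃⁺ g (here refl) x∈gj = p⊆p∪q _ x∈gj
∈⋃⁺ g (there j∈l) x∈gj = q⊆p∪q _ _ (∈⋃⁺ g j∈l x∈gj)

∈⋃⁻ : ∀ {n k} {x : Fin n} (g : Fin k → Subset n) (l : List (Fin k)) →
      x ∈ ⋃ (map g l) → ∃ λ j → x ∈ g j
∈⋃⁻ g []      x∈⋃ = contradiction x∈⋃ ∉⊥
∈⋃⁻ g (j ∷ l) x∈⋃ with x∈p∪q⁻ _ _ x∈⋃
... | inj₁ x∈gj = j , x∈gj
... | inj₂ x∈⋃l = ∈⋃⁻ g l x∈⋃l

∈⋂⁺ : ∀ {n k} {x : Fin n} (g : Fin k → Subset n) (l : List (Fin k)) →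
      (∀ j → x ∈ g j) → x ∈ ⋂ (map g l)
∈⋂⁺ g []      x∈g = ∈⊤
∈⋂⁺ g (j ∷ l) x∈g = x∈p∩q⁺ (x∈g j , ∈⋂⁺ g l x∈g)

∈-select⁺ : ∀ {n m} {σ : Subset m} {j} {P Q : Subset n} {x} →
            (j ∈ σ → x ∈ P) → (j ∉ σ → x ∈ Q) → x ∈ (if lookup σ j then P else Q)
∈-select⁺ {σ = σ} {j} x∈P x∈Q with lookup σ j in σj
... | true  = x∈P (lookup⇒[]= j σ σj)
... | false = x∈Q λ j∈σ → contradiction (trans (sym σj) ([]=⇒lookup j∈σ)) λ ()

∈-select⁻ : ∀ {n m} {σ : Subset m} {j} {P : Subset n} {x} →
            x ∈ (if lookup σ j then P else ⊥) → j ∈ σ × x ∈ P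
∈-select⁻ {σ = σ} {j} x∈sel with lookup σ j in σj
... | true  = lookup⇒[]= j σ σj , x∈sel
... | false = contradiction x∈sel ∉⊥

module MatroidFacts {n : ℕ} (M : Matroid n) where

  -- Augmenting L from T until it is at least as large as T (k bounds the
  -- number of augmentation steps still needed).
  augment-to : ∀ k (L T : Subset n) → Indep M L → Indep M T → ∣ T ∣ ≤ k + ∣ L ∣ →
               ∃ λ L′ → Indep M L′ × L ⊆ L′ × L′ ⊆ L ∪ T × ∣ T ∣ ≤ ∣ L′ ∣
  augment-to k L T indL indT bound with ∣ T ∣ ≤? ∣ L ∣
  ... | yes ∣T∣≤∣L∣ = L , indL , (λ x∈L → x∈L) , p⊆p∪q T , ∣T∣≤∣L∣
  augment-to zero    L T indL indT bound | no ∣T∣≰∣L∣ = contradiction bound ∣T∣≰∣L∣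
  augment-to (suc k) L T indL indT bound | no ∣T∣≰∣L∣
    with augment M indL indT (≰⇒> ∣T∣≰∣L∣)
  ... | x , x∈T , x∉L , indxL
    with augment-to k (⁅ x ⁆ ∪ L) T indxL indT bound′
    where
    grows : suc ∣ L ∣ ≤ ∣ ⁅ x ⁆ ∪ L ∣
    grows = subst (λ c → c + ∣ L ∣ ≤ ∣ ⁅ x ⁆ ∪ L ∣) (∣⁅x⁆∣≡1 x)
              (disjoint⇒∣p∣+∣q∣≤∣p∪q∣ ⁅ x ⁆ L λ y∈⁅x⁆ y∈L →
                 x∉L (subst (_∈ L) (x∈⁅y⁆⇒x≡y x y∈⁅x⁆) y∈L))
    bound′ : ∣ T ∣ ≤ k + ∣ ⁅ x ⁆ ∪ L ∣
    bound′ = ≤-trans bound (subst (_≤ k + ∣ ⁅ x ⁆ ∪ L ∣) (+-suc k ∣ L ∣) (+-monoʳ-≤ k grows))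
  ... | L′ , indL′ , xL⊆L′ , L′⊆xL∪T , ∣T∣≤∣L′∣ =
    L′ , indL′ , (λ y∈L → xL⊆L′ (q⊆p∪q ⁅ x ⁆ L y∈L)) , L′⊆L∪T , ∣T∣≤∣L′∣
    where
    L′⊆L∪T : L′ ⊆ L ∪ T
    L′⊆L∪T y∈L′ with x∈p∪q⁻ _ _ (L′⊆xL∪T y∈L′)
    ... | inj₂ y∈T  = q⊆p∪q L T y∈T
    ... | inj₁ y∈xL with x∈p∪q⁻ _ _ y∈xL
    ... | inj₂ y∈L  = p⊆p∪q T y∈L
    ... | inj₁ y∈⁅x⁆ = q⊆p∪q L T (subst (_∈ T) (sym (x∈⁅y⁆⇒x≡y x y∈⁅x⁆)) x∈T)

  basis-largest : ∀ {A B P} → IsBasisOf M A B → P ⊆ A → Indep M P → ∣ P ∣ ≤ ∣ B ∣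
  basis-largest (B⊆A , indB , maximal) P⊆A indP = ≮⇒≥ λ ∣B∣<∣P∣ →
    let (z , z∈P , z∉B , indzB) = augment M indB indP ∣B∣<∣P∣
    in maximal z (P⊆A z∈P) z∉B indzB

  basis-cong : ∀ {A A′ B} → A ⊆ A′ → A′ ⊆ A → IsBasisOf M A B → IsBasisOf M A′ B
  basis-cong A⊆A′ A′⊆A (B⊆A , indB , maximal) =
    (λ x∈B → A⊆A′ (B⊆A x∈B)) , indB , λ x x∈A′ → maximal x (A′⊆A x∈A′)

  -- Augment J from K ∪ B to L′; L′ ∩ A is at most ∣ B ∣ large, so L′ ∖ A ⊆ K
  -- must have at least ∣ K ∣ elements, i.e. K ⊆ L′.
  contraction-union : ∀ {A B K J} → IsBasisOf M A B → K ⊆ ∁ A → Indep M (K ∪ B) →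
                      J ⊆ A → Indep M J → Indep M (K ∪ J)
  contraction-union {A} {B} {K} {J} basis@(B⊆A , _ , _) K⊆∁A indKB J⊆A indJ
    with augment-to ∣ K ∪ B ∣ J (K ∪ B) indJ indKB (m≤m+n _ _)
  ... | L′ , indL′ , J⊆L′ , L′⊆J∪KB , ∣KB∣≤∣L′∣ = indep-⊆ M K∪J⊆L′ indL′
    where
    L′─A⊆K : L′ ─ A ⊆ K
    L′─A⊆K {z} z∈L′─A with x∈p∪q⁻ _ _ (L′⊆J∪KB (p─q⊆p L′ A z∈L′─A))
    ... | inj₁ z∈J  = contradiction (J⊆A z∈J) (x∈p─q⇒x∉q L′ A z∈L′─A)
    ... | inj₂ z∈KB with x∈p∪q⁻ _ _ z∈KB
    ... | inj₁ z∈K  = z∈K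
    ... | inj₂ z∈B  = contradiction (B⊆A z∈B) (x∈p─q⇒x∉q L′ A z∈L′─A)
    ∣K∣+∣B∣≤∣L′─A∣+∣B∣ : ∣ K ∣ + ∣ B ∣ ≤ ∣ L′ ─ A ∣ + ∣ B ∣
    ∣K∣+∣B∣≤∣L′─A∣+∣B∣ =
      ≤-trans (disjoint⇒∣p∣+∣q∣≤∣p∪q∣ K B λ z∈K z∈B → x∈∁p⇒x∉p (K⊆∁A z∈K) (B⊆A z∈B))
     (≤-trans ∣KB∣≤∣L′∣
     (≤-trans (∣p∣≤∣p─q∣+∣p∩q∣ L′ A)
              (+-monoʳ-≤ ∣ L′ ─ A ∣
                 (basis-largest basis (p∩q⊆q L′ A) (indep-⊆ M (p∩q⊆p L′ A) indL′)))))
    K⊆L′ : K ⊆ L′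
    K⊆L′ z∈K = p─q⊆p L′ A
      (⊆∧∣q∣≤∣p∣⇒q⊆p L′─A⊆K (+-cancelʳ-≤ ∣ B ∣ _ _ ∣K∣+∣B∣≤∣L′─A∣+∣B∣) z∈K)
    K∪J⊆L′ : K ∪ J ⊆ L′
    K∪J⊆L′ z∈K∪J with x∈p∪q⁻ _ _ z∈K∪J
    ... | inj₁ z∈K = K⊆L′ z∈K
    ... | inj₂ z∈J = J⊆L′ z∈J

module Blocks {n m : ℕ} (F : Fin m → Subset n) where

  ∈F⁺⁺ : ∀ {σ j x} → j ∈ σ → x ∈ F j → x ∈ F⁺ F σ
  ∈F⁺⁺ {σ} j∈σ x∈Fj = ∈⋃⁺ (λ i → if lookup σ i then F i else ⊥) (∈-allFin _)
                             (∈-select⁺ (λ _ → x∈Fj) (contradiction j∈σ))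

  ∈F⁺⁻ : ∀ {σ x} → x ∈ F⁺ F σ → ∃ λ j → j ∈ σ × x ∈ F j
  ∈F⁺⁻ x∈F⁺ with ∈⋃⁻ _ (allFin m) x∈F⁺
  ... | j , x∈sel = j , ∈-select⁻ x∈sel

  ∈F⁻⁺ : ∀ {σ x} → (∀ j → j ∉ σ → x ∈ F j) → x ∈ F⁻ F σ
  ∈F⁻⁺ x∈F = ∈⋂⁺ _ (allFin m) λ j → ∈-select⁺ (λ _ → ∈⊤) (x∈F j)

  F⁺⁅i⁆⊆Fi : ∀ {i} → F⁺ F ⁅ i ⁆ ⊆ F i
  F⁺⁅i⁆⊆Fi {i} x∈F⁺ with ∈F⁺⁻ x∈F⁺
  ... | j , j∈⁅i⁆ , x∈Fj = subst (λ k → _ ∈ F k) (x∈⁅y⁆⇒x≡y i j∈⁅i⁆) x∈Fj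

  Fi⊆F⁺⁅i⁆ : ∀ {i} → F i ⊆ F⁺ F ⁅ i ⁆
  Fi⊆F⁺⁅i⁆ {i} = ∈F⁺⁺ (x∈⁅x⁆ i)

  X : Subset m → Subset n
  X σ = F⁻ F σ ─ F⁺ F σ

  incidence : Fin n → Subset m
  incidence e = tabulate λ j → lookup (F j) e

  sig : Fin n → Subset m
  sig e = ∁ (incidence e)

  ∈sig⁺ : ∀ {e j} → e ∉ F j → j ∈ sig e
  ∈sig⁺ {e} {j} e∉Fj = x∉p⇒x∈∁p λ j∈inc →
    e∉Fj (lookup⇒[]= e (F j) (trans (sym (lookup∘tabulate _ j)) ([]=⇒lookup j∈inc)))

  ∈sig⁻ : ∀ {e j} → j ∈ sig e → e ∉ F j
  ∈sig⁻ {e} {j} j∈sig e∈Fj = x∈∁p⇒x∉p j∈sig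
    (lookup⇒[]= j (incidence e) (trans (lookup∘tabulate _ j) ([]=⇒lookup e∈Fj)))

  ∉F⁺⇒⊆sig : ∀ {τ e} → e ∉ F⁺ F τ → τ ⊆ sig e
  ∉F⁺⇒⊆sig {e = e} e∉F⁺ {j} j∈τ with e ∈? F j
  ... | yes e∈Fj = contradiction (∈F⁺⁺ j∈τ e∈Fj) e∉F⁺
  ... | no  e∉Fj = ∈sig⁺ e∉Fj

  sig⊆⇒∈F⁻ : ∀ {τ e} → sig e ⊆ τ → e ∈ F⁻ F τ
  sig⊆⇒∈F⁻ {τ} {e} sig⊆τ = ∈F⁻⁺ e∈F
    where
    e∈F : ∀ j → j ∉ τ → e ∈ F j
    e∈F j j∉τ with e ∈? F j
    ... | yes e∈Fj = e∈Fj
    ... | no  e∉Fj = contradiction (sig⊆τ (∈sig⁺ e∉Fj)) j∉τ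

  ∈X-sig : ∀ e → e ∈ X (sig e)
  ∈X-sig e = x∈p∧x∉q⇒x∈p─q (sig⊆⇒∈F⁻ (λ j∈sig → j∈sig)) λ e∈F⁺ →
    let (j , j∈sig , e∈Fj) = ∈F⁺⁻ e∈F⁺ in ∈sig⁻ j∈sig e∈Fj

  -- An element outside F⁺_{sig e} whose signature is no larger than that of
  -- e lies in the block of e: its signature contains, hence equals, sig e.
  ∉F⁺⇒∈X : ∀ {e e′} → e′ ∉ F⁺ F (sig e) → ∣ sig e′ ∣ ≤ ∣ sig e ∣ → e′ ∈ X (sig e)
  ∉F⁺⇒∈X {e} e′∉F⁺ ∣sig-e′∣≤∣sig-e∣ =
    x∈p∧x∉q⇒x∈p─q (sig⊆⇒∈F⁻ (⊆∧∣q∣≤∣p∣⇒q⊆p (∉F⁺⇒⊆sig {sig e} e′∉F⁺) ∣sig-e′∣≤∣sig-e∣))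
                  e′∉F⁺

module OdotIndependent {n m : ℕ} (M : Matroid n) (F : Fin m → Subset n) (I : Subset n)
                       (indI : IndepOdot M F I) where
  open MatroidFacts M
  open Blocks F

  block-union : ∀ σ {J} → J ⊆ F⁺ F σ → Indep M J → Indep M ((I ∩ X σ) ∪ J)
  block-union σ J⊆F⁺ indJ with indI σ
  ... | _ , K⊆∁F⁺ , _ , basis , indKB = contraction-union basis K⊆∁F⁺ indKB J⊆F⁺ indJ

  absorb : ∀ {S e} → Indep M S → e ∈ I →
           (∀ {e′} → e′ ∈ S → e′ ∈ F⁺ F (sig e) ⊎ e′ ∈ I ∩ X (sig e)) →
           Indep M (⁅ e ⁆ ∪ S)
  absorb {S} {e} indS e∈I placed =
    indep-⊆ M eS⊆ (block-union (sig e) (p∩q⊆q S _) (indep-⊆ M (p∩q⊆p S _) indS))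
    where
    eS⊆ : ⁅ e ⁆ ∪ S ⊆ (I ∩ X (sig e)) ∪ (S ∩ F⁺ F (sig e))
    eS⊆ x∈eS with x∈p∪q⁻ _ _ x∈eS
    ... | inj₁ x∈⁅e⁆ = p⊆p∪q _ (subst (_∈ I ∩ X (sig e)) (sym (x∈⁅y⁆⇒x≡y e x∈⁅e⁆))
                                      (x∈p∩q⁺ (e∈I , ∈X-sig e)))
    ... | inj₂ x∈S with placed x∈S
    ... | inj₁ x∈F⁺   = q⊆p∪q _ _ (x∈p∩q⁺ (x∈S , x∈F⁺))
    ... | inj₂ x∈I∩X  = p⊆p∪q _ x∈I∩X

  -- Main induction (on ∣ S ∣ < k): a subset S of I can be added to an
  -- independent J lying inside F⁺_{sig e} for every e ∈ S.  The element of S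
  -- of largest signature is absorbed last.
  grow : ∀ k (S J : Subset n) → ∣ S ∣ < k → S ⊆ I → Indep M J →
         (∀ {e} → e ∈ S → J ⊆ F⁺ F (sig e)) → Indep M (S ∪ J)
  grow zero S J () S⊆I indJ J⊆F⁺
  grow (suc k) S J (s≤s ∣S∣≤k) S⊆I indJ J⊆F⁺ with argmax (λ e → ∣ sig e ∣) S
  ... | inj₁ S-empty = indep-⊆ M S∪J⊆J indJ
    where
    S∪J⊆J : S ∪ J ⊆ J
    S∪J⊆J x∈S∪J with x∈p∪q⁻ _ _ x∈S∪J
    ... | inj₁ x∈S = contradiction x∈S (S-empty _)
    ... | inj₂ x∈J = x∈J
  ... | inj₂ (e , e∈S , largest) = indep-⊆ M S∪J⊆ (absorb indRest (S⊆I e∈S) placed)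
    where
    S-e⊆S : S - e ⊆ S
    S-e⊆S = p─q⊆p S ⁅ e ⁆
    indRest : Indep M ((S - e) ∪ J)
    indRest = grow k (S - e) J (<-≤-trans (x∈p⇒∣p-x∣<∣p∣ e∈S) ∣S∣≤k)
                (λ x∈S-e → S⊆I (S-e⊆S x∈S-e)) indJ (λ x∈S-e → J⊆F⁺ (S-e⊆S x∈S-e))
    placed : ∀ {e′} → e′ ∈ (S - e) ∪ J → e′ ∈ F⁺ F (sig e) ⊎ e′ ∈ I ∩ X (sig e)
    placed x∈rest with x∈p∪q⁻ _ _ x∈rest
    ... | inj₂ x∈J = inj₁ (J⊆F⁺ e∈S x∈J)
    ... | inj₁ x∈S-e with _ ∈? F⁺ F (sig e)
    ... | yes x∈F⁺ = inj₁ x∈F⁺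
    ... | no  x∉F⁺ = inj₂ (x∈p∩q⁺ (S⊆I (S-e⊆S x∈S-e) , ∉F⁺⇒∈X x∉F⁺ (largest (S-e⊆S x∈S-e))))
    S∪J⊆ : S ∪ J ⊆ ⁅ e ⁆ ∪ ((S - e) ∪ J)
    S∪J⊆ {x} x∈S∪J with x∈p∪q⁻ _ _ x∈S∪J
    ... | inj₂ x∈J = q⊆p∪q _ _ (q⊆p∪q (S - e) J x∈J)
    ... | inj₁ x∈S with x ≟ e
    ... | yes refl = p⊆p∪q _ (x∈⁅x⁆ e)
    ... | no  x≢e  = q⊆p∪q _ _ (p⊆p∪q J (x∈p∧x≢y⇒x∈p-y x∈S x≢e))

  -- I ∩ Fᵢ is independent in M|Fᵢ, since I itself is independent in M.
  restricted-part : ∀ i → IndepRestr M (F i) (I ∩ F i)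
  restricted-part i = p∩q⊆q I (F i) , indep-⊆ M (λ x∈I∩Fi → p⊆p∪q ⊥ (p∩q⊆p I (F i) x∈I∩Fi))
    (grow (suc ∣ I ∣) I ⊥ ≤-refl (λ x∈I → x∈I) (indep-∅ M) λ _ x∈⊥ → contradiction x∈⊥ ∉⊥)

  -- I ∖ Fᵢ is independent in M / Fᵢ: add it to the basis B of Fᵢ = F⁺_{⁅i⁆}
  -- given by the ⁅i⁆-summand; B ⊆ Fᵢ ⊆ F⁺_{sig e} for every e ∉ Fᵢ.
  contracted-part : ∀ i → IndepContr M (F i) (I ─ F i)
  contracted-part i with indI ⁅ i ⁆
  ... | _ , _ , B , basis@(B⊆F⁺ , indB , _) , _ =
    (λ x∈I─Fi → x∉p⇒x∈∁p (x∈p─q⇒x∉q I (F i) x∈I─Fi)) , B ,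
    basis-cong F⁺⁅i⁆⊆Fi Fi⊆F⁺⁅i⁆ basis ,
    grow (suc ∣ I ─ F i ∣) (I ─ F i) B ≤-refl (p─q⊆p I (F i)) indB
      λ e∈I─Fi x∈B → ∈F⁺⁺ (∈sig⁺ (x∈p─q⇒x∉q I (F i) e∈I─Fi)) (F⁺⁅i⁆⊆Fi (B⊆F⁺ x∈B))

corollary2p23 : (n m : ℕ) (M : Matroid n) (F : Fin m → Subset n) (I : Subset n) →
    IndepOdot M F I → (i : Fin m) → IndepMF M (F i) I
corollary2p23 n m M F I indI i = contracted-part i , restricted-part i
  where open OdotIndependent M F I indI
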